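{- Let $\alpha$ be a complete linear ordering and $R$ a binary relation on $\alpha$ which is upward closed. Then there exists $\gamma\subseteq\alpha$ such that for all $x<y$ in $\alpha$: (i) if $R(x,y)$ then $[x,y]\cap\gamma\neq\emptyset$; (ii) if $]x,y[\cap\gamma$ contains two distinct elements then $R(x,y)$.
   Context: A linear ordering is complete if every nonempty subset with an upper bound has a least upper bound and every nonempty subset with a lower bound has a greatest lower bound. A binary relation $R$ on $\alpha$ is upward closed if for all $x\le x'<y'\le y$, $R(x',y')$ implies $R(x,y)$. -}

module Defs where

open import Level using (Level)
open import Data.Product using (Σ; ∃; _×_; _,_)
open import Data.Sum using (_⊎_)
open import Relation.Binary.Core using (Rel)
open import Relation.Binary.PropositionalEquality using (_≡_; _≢_)
open import Relation.Unary using (Pred)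

module _ {a : Level} {α : Set a} (_<_ : Rel α a) where

  _≤_ : Rel α a
  x ≤ y = (x < y) ⊎ (x ≡ y)

  UpperBound : Pred α a → α → Set a
  UpperBound S u = ∀ x → S x → x ≤ u

  LowerBound : Pred α a → α → Set a
  LowerBound S l = ∀ x → S x → l ≤ x

  IsLUB : Pred α a → α → Set a
  IsLUB S s = UpperBound S s × (∀ u → UpperBound S u → s ≤ u)

  IsGLB : Pred α a → α → Set a
  IsGLB S s = LowerBound S s × (∀ l → LowerBound S l → l ≤ s)

  Complete : Set _
  Complete =
    (∀ (S : Pred α a) → ∃ S → ∃ (UpperBound S) → ∃ (IsLUB S)) ×
    (∀ (S : Pred α a) → ∃ S → ∃ (LowerBound S) → ∃ (IsGLB S))

  UpwardClosed : Rel α a → Set a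
  UpwardClosed R = ∀ x x' y' y → x ≤ x' → x' < y' → y' ≤ y → R x' y' → R x y

{-# OPTIONS --safe #-}

-- Sweep to the right from a point t: put next t := inf { y > t | R t y } into γ, then
-- next (next t), and so on transfinitely, taking suprema at limit stages (completeness).
-- By induction over the sweep, for swept points w < z the successor next w lies in [w, z],
-- so every interval around [w, z] contains one around [w, next w], which is in R by
-- definition of the infimum and upward closure: this is (ii). The sweep overtakes every
-- R-interval [x, y] to the right of t, since the last swept point w ≤ x has next w ≤ y,
-- unless it gets stuck at a stall point s with R s v for all v > s. Stall points (and
-- their mirror images) may always go into γ, as every interval around one is in R. Each
-- stall-free component is therefore swept in both directions from one representative,
-- chosen with excluded middle from the supremum of the stall points below the component,
-- so that all its points agree on it.

module Submission where

open import Defs hiding (_≤_)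
open import Level using (Level)
open import Data.Product using (Σ; ∃; ∃₂; _×_; _,_; proj₁; proj₂)
open import Data.Sum using (_⊎_; inj₁; inj₂)
import Data.Sum as Sum
open import Data.Maybe using (Maybe; just; nothing)
open import Data.Maybe.Properties using (just-injective)
open import Data.Empty using (⊥-elim)
open import Function using (flip)
open import Relation.Binary.Core using (Rel)
open import Relation.Binary.Structures using (IsStrictTotalOrder)
open import Relation.Binary.Definitions using (tri<; tri≈; tri>)
open import Relation.Binary.PropositionalEquality
  using (_≡_; _≢_; refl; sym; trans; cong; subst; isEquivalence)
open import Relation.Unary using (Pred; _⊆_)
open import Relation.Nullary using (¬_; yes; no)
open import Axiom.ExcludedMiddle using (ExcludedMiddle)
import Relation.Binary.Construct.Flip.EqAndOrd as Flip
import Relation.Binary.Construct.StrictToNonStrict as NonStrict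

module Converse {a} {α : Set a} {_<_ : Rel α a} where

  open NonStrict _≡_ _<_ using (_≤_)
  open NonStrict _≡_ (flip _<_) using () renaming (_≤_ to _≥_)

  private variable
    x y s : α
    S : Pred α a

  ≥⇒≤ : x ≥ y → y ≤ x
  ≥⇒≤ = Sum.map₂ sym

  ≤⇒≥ : x ≤ y → y ≥ x
  ≤⇒≥ = Sum.map₂ sym

  IsGLB⇒IsLUB-flip : IsGLB _<_ S s → IsLUB (flip _<_) S s
  IsGLB⇒IsLUB-flip (lower , greatest) =
    (λ x Sx → ≤⇒≥ (lower x Sx)) ,
    (λ u ub → ≤⇒≥ (greatest u (λ x Sx → ≥⇒≤ (ub x Sx))))

  IsLUB⇒IsGLB-flip : IsLUB _<_ S s → IsGLB (flip _<_) S s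
  IsLUB⇒IsGLB-flip (upper , least) =
    (λ x Sx → ≤⇒≥ (upper x Sx)) ,
    (λ l lb → ≤⇒≥ (least l (λ x Sx → ≥⇒≤ (lb x Sx))))

  complete-flip : Complete _<_ → Complete (flip _<_)
  complete-flip (lub , glb) =
    (λ S ne (u , ub) → let s , isGLB = glb S ne (u , λ x Sx → ≥⇒≤ (ub x Sx))
                       in s , IsGLB⇒IsLUB-flip isGLB) ,
    (λ S ne (l , lb) → let s , isLUB = lub S ne (l , λ x Sx → ≥⇒≤ (lb x Sx))
                       in s , IsLUB⇒IsGLB-flip isLUB)

  upwardClosed-flip : {R : Rel α a} → UpwardClosed _<_ R → UpwardClosed (flip _<_) (flip R)
  upwardClosed-flip R-up x x' y' y x≥x' y'<x' y'≥y =
    R-up y y' x' x (≥⇒≤ y'≥y) y'<x' (≥⇒≤ x≥x')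

module TotalOrder {a} {α : Set a} {_<_ : Rel α a} (sto : IsStrictTotalOrder _≡_ _<_) where

  open IsStrictTotalOrder sto public using (compare; _<?_)
  open IsStrictTotalOrder sto using (<-resp-≈; <-respˡ-≈; <-respʳ-≈)
    renaming (trans to <-trans; irrefl to <-irrefl)
  open NonStrict _≡_ _<_ public using (_≤_; <⇒≤)

  private variable
    x y z s s' : α
    P Q : Pred α a

  ≤-refl : x ≤ x
  ≤-refl = inj₂ refl

  ≤-trans : x ≤ y → y ≤ z → x ≤ z
  ≤-trans = NonStrict.trans _≡_ _<_ isEquivalence <-resp-≈ <-trans

  <-≤-trans : x < y → y ≤ z → x < z
  <-≤-trans = NonStrict.<-≤-trans _≡_ _<_ <-trans <-respʳ-≈

  ≤-<-trans : x ≤ y → y < z → x < z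
  ≤-<-trans = NonStrict.≤-<-trans _≡_ _<_ sym <-trans <-respˡ-≈

  ≤-antisym : x ≤ y → y ≤ x → x ≡ y
  ≤-antisym = NonStrict.antisym _≡_ _<_ isEquivalence <-trans <-irrefl

  <⇒≱ : x < y → ¬ y ≤ x
  <⇒≱ x<y y≤x = <-irrefl refl (<-≤-trans x<y y≤x)

  ≮⇒≥ : ¬ x < y → y ≤ x
  ≮⇒≥ {x} {y} x≮y with compare x y
  ... | tri< x<y _ _ = ⊥-elim (x≮y x<y)
  ... | tri≈ _ x≡y _ = inj₂ (sym x≡y)
  ... | tri> _ _ y<x = inj₁ y<x

  ≤∧≢⇒< : x ≤ y → x ≢ y → x < y
  ≤∧≢⇒< (inj₁ x<y) _   = x<y
  ≤∧≢⇒< (inj₂ x≡y) x≢y = ⊥-elim (x≢y x≡y)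

  IsLUB-unique : IsLUB _<_ P s → IsLUB _<_ P s' → s ≡ s'
  IsLUB-unique (upper , least) (upper' , least') = ≤-antisym (least _ upper') (least' _ upper)

  IsLUB-cong : P ⊆ Q → Q ⊆ P → IsLUB _<_ P s → IsLUB _<_ Q s
  IsLUB-cong P⊆Q Q⊆P (upper , least) =
    (λ x Qx → upper x (Q⊆P Qx)) , (λ u ub → least u (λ x Px → ub x (P⊆Q Px)))

module Choice {a} (em : ExcludedMiddle a) {α : Set a} where

  private variable
    t : α
    P : Pred α a

  ε : Pred α a → Maybe α
  ε P with em {∃ P}
  ... | yes (t , _) = just t
  ... | no _        = nothing

  ε-just : ε P ≡ just t → P t
  ε-just {P} eq with em {∃ P}
  ε-just {P} refl | yes (_ , Pt) = Pt

  ε-defined : ∃ P → ∃ λ t → ε P ≡ just t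
  ε-defined {P} ne with em {∃ P}
  ... | yes (t , _) = t , refl
  ... | no none     = ⊥-elim (none ne)

module Classical {a} (em : ExcludedMiddle a) {α : Set a} {_<_ : Rel α a}
  (sto : IsStrictTotalOrder _≡_ _<_) where

  open TotalOrder sto
  open Choice em

  private variable
    n s v w : α
    P Q : Pred α a

  glb-approx : IsGLB _<_ P n → n < v → ∃ λ y → P y × y < v
  glb-approx {P} {n} {v} (_ , greatest) n<v with em {∃ λ y → P y × y < v}
  ... | yes found = found
  ... | no none   =
    ⊥-elim (<⇒≱ n<v (greatest v (λ y Py → ≮⇒≥ (λ y<v → none (y , Py , y<v)))))

  lub-approx : IsLUB _<_ P s → w < s → ∃ λ x → P x × w < x
  lub-approx {P} {s} {w} (_ , least) w<s with em {∃ λ x → P x × w < x}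
  ... | yes found = found
  ... | no none   =
    ⊥-elim (<⇒≱ w<s (least w (λ x Px → ≮⇒≥ (λ w<x → none (x , Px , w<x)))))

  lub? : Pred α a → Maybe α
  lub? P = ε (IsLUB _<_ P)

  lub?-sound : lub? P ≡ just s → IsLUB _<_ P s
  lub?-sound = ε-just

  lub?-defined : IsLUB _<_ P s → lub? P ≡ just s
  lub?-defined isLUB with ε-defined (_ , isLUB)
  ... | _ , eq = trans eq (cong just (IsLUB-unique (ε-just eq) isLUB))

  lub?-cong : P ⊆ Q → Q ⊆ P → lub? P ≡ lub? Q
  lub?-cong {P} {Q} P⊆Q Q⊆P with lub? P in eqP | lub? Q in eqQ
  ... | just _ | just _ =
    cong just (IsLUB-unique (IsLUB-cong P⊆Q Q⊆P (lub?-sound eqP)) (lub?-sound eqQ))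
  ... | just _ | nothing
    with () ← trans (sym eqQ) (lub?-defined (IsLUB-cong P⊆Q Q⊆P (lub?-sound eqP)))
  ... | nothing | just _
    with () ← trans (sym eqP) (lub?-defined (IsLUB-cong Q⊆P P⊆Q (lub?-sound eqQ)))
  ... | nothing | nothing = refl

module Sweep {a} (em : ExcludedMiddle a) {α : Set a} {_<_ : Rel α a}
  (sto : IsStrictTotalOrder _≡_ _<_) (complete : Complete _<_)
  {R : Rel α a} (R-up : UpwardClosed _<_ R) where

  open TotalOrder sto
  open Classical em sto

  private variable
    t u v w x x' y y' z z' n n' s : α

  R-widenˡ : u ≤ x → x < y → R x y → R u y
  R-widenˡ u≤x x<y = R-up _ _ _ _ u≤x x<y ≤-refl

  R-widenʳ : x < y → y ≤ v → R x y → R x v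
  R-widenʳ x<y y≤v = R-up _ _ _ _ ≤-refl x<y y≤v

  Succ : α → Pred α a
  Succ z y = z < y × R z y

  Succ-widenˡ : w ≤ x → x < y → R x y → Succ w y
  Succ-widenˡ w≤x x<y Rxy = ≤-<-trans w≤x x<y , R-widenˡ w≤x x<y Rxy

  Next : Rel α a
  Next z n = ∃ (Succ z) × IsGLB _<_ (Succ z) n

  Stall : Pred α a
  Stall s = ∀ {v} → s < v → R s v

  Linked : Rel α a
  Linked x y = ∀ {u v} → u < x → y < v → R u v

  Linked-mono : x' ≤ x → y ≤ y' → Linked x y → Linked x' y'
  Linked-mono x'≤x y≤y' linked u<x' y'<v = linked (<-≤-trans u<x' x'≤x) (≤-<-trans y≤y' y'<v)

  next-exists : ∃ (Succ z) → ∃ (Next z)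
  next-exists {z} ne =
    let n , isGLB = proj₂ complete (Succ z) ne (z , λ _ (z<y , _) → <⇒≤ z<y) in n , ne , isGLB

  Next-unique : Next z n → Next z n' → n ≡ n'
  Next-unique (_ , lower , greatest) (_ , lower' , greatest') =
    ≤-antisym (greatest' _ lower) (greatest _ lower')

  Next⇒≤ : Next z n → z ≤ n
  Next⇒≤ {z} (_ , _ , greatest) = greatest z (λ _ (z<y , _) → <⇒≤ z<y)

  Next-R : Next z n → n < v → R z v
  Next-R (_ , isGLB) n<v with glb-approx isGLB n<v
  ... | y , (z<y , Rzy) , y<v = R-widenʳ z<y (<⇒≤ y<v) Rzy

  Next-linked : Next z n → Linked z n
  Next-linked next u<z n<v =
    R-widenˡ (<⇒≤ u<z) (≤-<-trans (Next⇒≤ next) n<v) (Next-R next n<v)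

  -- A limit stage is given by cofinality of earlier stages rather than as the supremum
  -- of a subset, which keeps Reach t in Set a (see Reach-lub for the latter form).
  data Reach (t : α) : Pred α a where
    start : Reach t t
    step  : Reach t z → Next z n → Reach t n
    limit : t ≤ s → (∀ {x} → x < s → ∃ λ y → Reach t y × x < y × y < s) → Reach t s

  Reach⇒≥ : Reach t z → t ≤ z
  Reach⇒≥ start             = ≤-refl
  Reach⇒≥ (step reach next) = ≤-trans (Reach⇒≥ reach) (Next⇒≤ next)
  Reach⇒≥ (limit t≤s _)     = t≤s

  Reach-lub : {P : Pred α a} → ∃ P → P ⊆ Reach t → IsLUB _<_ P s → Reach t s
  Reach-lub {t} {s} {P} (x , Px) P⊆Reach isLUB@(upper , _) with em {P s}
  ... | yes Ps = P⊆Reach Ps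
  ... | no ¬Ps = limit (≤-trans (Reach⇒≥ (P⊆Reach Px)) (upper x Px)) cofinal
    where
    cofinal : ∀ {u} → u < s → ∃ λ y → Reach t y × u < y × y < s
    cofinal u<s with lub-approx isLUB u<s
    ... | y , Py , u<y =
      y , P⊆Reach Py , u<y , ≤∧≢⇒< (upper y Py) (λ y≡s → ¬Ps (subst P y≡s Py))

  NextBelow : α → Pred α a
  NextBelow t z = ∀ {w} → Reach t w → w < z → ∃ λ n → Next w n × n ≤ z

  Reach-dichotomy : Reach t z → NextBelow t z → Reach t w → w ≤ z ⊎ ∃ λ n → Next z n × n ≤ w
  Reach-dichotomy reach-z below start = inj₁ (Reach⇒≥ reach-z)
  Reach-dichotomy reach-z below (step reach-w next) with Reach-dichotomy reach-z below reach-w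
  ... | inj₁ (inj₂ refl) = inj₂ (_ , next , ≤-refl)
  ... | inj₁ (inj₁ w<z) with below reach-w w<z
  ...   | _ , next' , n≤z = inj₁ (subst (_≤ _) (Next-unique next' next) n≤z)
  Reach-dichotomy reach-z below (step reach-w next) | inj₂ (n , nextz , n≤w) =
    inj₂ (n , nextz , ≤-trans n≤w (Next⇒≤ next))
  Reach-dichotomy {z = z} reach-z below (limit {s} _ cofinal) with z <? s
  ... | no z≮s  = inj₁ (≮⇒≥ z≮s)
  ... | yes z<s with cofinal z<s
  ...   | y , reach-y , z<y , y<s with Reach-dichotomy reach-z below reach-y
  ...     | inj₁ y≤z = ⊥-elim (<⇒≱ z<y y≤z)
  ...     | inj₂ (n , nextz , n≤y) = inj₂ (n , nextz , ≤-trans n≤y (<⇒≤ y<s))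

  next-below : Reach t z → NextBelow t z
  next-below start reach-w w<t = ⊥-elim (<⇒≱ w<t (Reach⇒≥ reach-w))
  next-below (step reach-z next) reach-w w<n with Reach-dichotomy reach-z (next-below reach-z) reach-w
  ... | inj₁ (inj₂ refl) = _ , next , ≤-refl
  ... | inj₁ (inj₁ w<z) with next-below reach-z reach-w w<z
  ...   | m , nextw , m≤z = m , nextw , ≤-trans m≤z (Next⇒≤ next)
  next-below (step reach-z next) reach-w w<n | inj₂ (_ , nextz , n'≤w) =
    ⊥-elim (<⇒≱ w<n (subst (_≤ _) (Next-unique nextz next) n'≤w))
  next-below (limit _ cofinal) reach-w w<s with cofinal w<s
  ... | y , reach-y , w<y , y<s with next-below reach-y reach-w w<y
  ...   | m , nextw , m≤y = m , nextw , ≤-trans m≤y (<⇒≤ y<s)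

  Reach-linked : Reach t z → Reach t z' → z < z' → Linked z z'
  Reach-linked reach-z reach-z' z<z' with next-below reach-z' reach-z z<z'
  ... | n , next , n≤z' = Linked-mono ≤-refl n≤z' (Next-linked next)

  last-before : t ≤ x → ∃ λ w → Reach t w × w ≤ x × (∀ {z} → Reach t z → z ≤ x → z ≤ w)
  last-before {t} {x} t≤x =
    let w , upper , least = proj₁ complete Before (t , start , t≤x) (x , λ _ → proj₂)
    in w , Reach-lub (t , start , t≤x) proj₁ (upper , least) , least x (λ _ → proj₂) ,
       λ reach-z z≤x → upper _ (reach-z , z≤x)
    where
    Before : Pred α a
    Before z = Reach t z × z ≤ x

  reach-meets : t ≤ x → x < y → R x y → (∀ {s} → t ≤ s → s ≤ x → ¬ Stall s) →
                ∃ λ z → Reach t z × x ≤ z × z ≤ y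
  reach-meets {t} {x} {y} t≤x x<y Rxy no-stall with last-before t≤x
  ... | w , reach-w , w≤x , maximal with next-exists (y , Succ-widenˡ w≤x x<y Rxy)
  ...   | n , next@(_ , lower , _) with n <? x
  ...     | no n≮x  = n , step reach-w next , ≮⇒≥ n≮x , lower y (Succ-widenˡ w≤x x<y Rxy)
  ...     | yes n<x = ⊥-elim (no-stall (Reach⇒≥ reach-w) w≤x w-stalls)
    where
    w-stalls : Stall w
    w-stalls w<v = Next-R next (≤-<-trans (maximal (step reach-w next) (<⇒≤ n<x)) w<v)

module Construction {a} (em : ExcludedMiddle a) {α : Set a} {_<_ : Rel α a}
  (sto : IsStrictTotalOrder _≡_ _<_) (complete : Complete _<_)
  {R : Rel α a} (R-up : UpwardClosed _<_ R) where

  open TotalOrder sto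
  open Classical em sto
  open Choice em
  open Converse {_<_ = _<_} using (≥⇒≤; complete-flip; upwardClosed-flip)

  module Right = Sweep em sto complete R-up
  module Left = Sweep em (Flip.isStrictTotalOrder sto) (complete-flip complete) (upwardClosed-flip R-up)

  open Right using (Linked; Linked-mono; R-widenˡ; R-widenʳ)

  private variable
    c s x y z : α

  Linked-flip : Left.Linked y x → Linked x y
  Linked-flip linked u<x y<v = linked y<v u<x

  Stall : Pred α a
  Stall s = Right.Stall s ⊎ Left.Stall s

  Stall-linked : Stall s → x ≤ s → s ≤ y → Linked x y
  Stall-linked (inj₁ right) x≤s s≤y u<x y<v =
    R-widenˡ (<⇒≤ (<-≤-trans u<x x≤s)) (≤-<-trans s≤y y<v) (right (≤-<-trans s≤y y<v))
  Stall-linked (inj₂ left) x≤s s≤y u<x y<v =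
    R-widenʳ (<-≤-trans u<x x≤s) (<⇒≤ (≤-<-trans s≤y y<v)) (left (<-≤-trans u<x x≤s))

  StallFree : Rel α a
  StallFree x y = ∀ {s} → x ≤ s → s ≤ y → ¬ Stall s

  StallBelow : α → Pred α a
  StallBelow x s = Stall s × s < x

  key : α → Maybe α
  key x = lub? (StallBelow x)

  StallBelow-bounded : UpperBound _<_ (StallBelow x) x
  StallBelow-bounded _ (_ , s<x) = <⇒≤ s<x

  stall-between⇒key≢ : x < s → s < y → Stall s → key x ≢ key y
  stall-between⇒key≢ {x} {s} {y} x<s s<y st kx≡ky
    with proj₁ complete (StallBelow y) (s , st , s<y) (y , StallBelow-bounded)
  ... | l , isLUB-y@(upper-y , _) = <⇒≱ x<s (≤-trans (upper-y s (st , s<y)) l≤x)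
    where
    l≤x : l ≤ x
    l≤x = proj₂ (lub?-sound (trans kx≡ky (lub?-defined isLUB-y))) x StallBelow-bounded

  key-constant : x ≤ y → StallFree x y → key x ≡ key y
  key-constant {x} {y} x≤y free = lub?-cong (λ (st , s<x) → st , <-≤-trans s<x x≤y) below-x
    where
    below-x : StallBelow y ⊆ StallBelow x
    below-x {s} (st , s<y) with s <? x
    ... | yes s<x = st , s<x
    ... | no s≮x  = ⊥-elim (free (≮⇒≥ s≮x) (<⇒≤ s<y) st)

  key≡⇒StallFree : ¬ Stall x → ¬ Stall y → key x ≡ key y → StallFree x y
  key≡⇒StallFree ¬x _  _     (inj₂ refl) _           = ¬x
  key≡⇒StallFree _  ¬y _     (inj₁ _)    (inj₂ refl) = ¬y
  key≡⇒StallFree _  _  kx≡ky (inj₁ x<s)  (inj₁ s<y)  st = stall-between⇒key≢ x<s s<y st kx≡ky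

  rep : Maybe α → Maybe α
  rep k = ε (λ c → ¬ Stall c × key c ≡ k)

  rep-just : rep (key x) ≡ just c → ¬ Stall c × key c ≡ key x
  rep-just = ε-just

  rep-defined : ¬ Stall x → ∃ λ c → rep (key x) ≡ just c
  rep-defined ¬x = ε-defined (_ , ¬x , refl)

  Swept : α → Pred α a
  Swept c z = Right.Reach c z ⊎ Left.Reach c z

  data Γ : Pred α a where
    stall : Stall z → Γ z
    swept : rep (key z) ≡ just c → Swept c z → Γ z

  Swept-linked : Swept c x → Swept c y → x < y → Linked x y
  Swept-linked (inj₁ right-x) (inj₁ right-y) x<y = Right.Reach-linked right-x right-y x<y
  Swept-linked (inj₂ left-x)  (inj₂ left-y)  x<y = Linked-flip (Left.Reach-linked left-y left-x x<y)
  Swept-linked (inj₁ right-x) (inj₂ left-y)  x<y =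
    ⊥-elim (<⇒≱ x<y (≤-trans (≥⇒≤ (Left.Reach⇒≥ left-y)) (Right.Reach⇒≥ right-x)))
  Swept-linked (inj₂ left-x)  (inj₁ right-y) x<y with Right.Reach⇒≥ right-y
  ... | inj₁ c<y  =
    Linked-mono (≥⇒≤ (Left.Reach⇒≥ left-x)) ≤-refl (Right.Reach-linked Right.start right-y c<y)
  ... | inj₂ refl = Linked-flip (Left.Reach-linked Left.start left-x x<y)

  stall-or-free : ∀ x y → (∃ λ s → Stall s × x ≤ s × s ≤ y) ⊎ StallFree x y
  stall-or-free x y with em {∃ λ s → Stall s × x ≤ s × s ≤ y}
  ... | yes found = inj₁ found
  ... | no none   = inj₂ (λ x≤s s≤y st → none (_ , st , x≤s , s≤y))

  Γ-linked : Γ x → Γ y → x < y → Linked x y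
  Γ-linked (stall st) _ x<y = Stall-linked st ≤-refl (<⇒≤ x<y)
  Γ-linked _ (stall st) x<y = Stall-linked st (<⇒≤ x<y) ≤-refl
  Γ-linked {x} {y} (swept rep-x swept-x) (swept rep-y swept-y) x<y with stall-or-free x y
  ... | inj₁ (s , st , x≤s , s≤y) = Stall-linked st x≤s s≤y
  ... | inj₂ free
    with just-injective (trans (sym rep-x) (trans (cong rep (key-constant (<⇒≤ x<y) free)) rep-y))
  ...   | refl = Swept-linked swept-x swept-y x<y

  Swept-meets : x < y → R x y → StallFree x y → ¬ Stall c → key c ≡ key x →
                ∃ λ z → x ≤ z × z ≤ y × Swept c z
  Swept-meets {x} {y} {c} x<y Rxy free ¬c kc≡kx with compare c x
  ... | tri≈ _ refl _ = c , ≤-refl , <⇒≤ x<y , inj₁ Right.start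
  ... | tri< c<x _ _
    with Right.reach-meets (<⇒≤ c<x) x<y Rxy (λ c≤s s≤x st → c-x-free c≤s s≤x (inj₁ st))
    where
    c-x-free : StallFree c x
    c-x-free = key≡⇒StallFree ¬c (free ≤-refl (<⇒≤ x<y)) kc≡kx
  ...   | z , reach , x≤z , z≤y = z , x≤z , z≤y , inj₁ reach
  Swept-meets {x} {y} {c} x<y Rxy free ¬c kc≡kx | tri> _ _ x<c with y <? c
  ... | no y≮c = c , <⇒≤ x<c , ≮⇒≥ y≮c , inj₁ Right.start
  ... | yes y<c
    with Left.reach-meets (inj₁ y<c) x<y Rxy
           (λ s≤c y≤s st → x-c-free (≤-trans (<⇒≤ x<y) (≥⇒≤ y≤s)) (≥⇒≤ s≤c) (inj₂ st))
    where
    x-c-free : StallFree x c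
    x-c-free = key≡⇒StallFree (free ≤-refl (<⇒≤ x<y)) ¬c (sym kc≡kx)
  ...   | z , reach , z≤y , x≤z = z , ≥⇒≤ x≤z , ≥⇒≤ z≤y , inj₂ reach

  Γ-swept : rep (key x) ≡ just c → x ≤ z → StallFree x z → Swept c z → Γ z
  Γ-swept rep-x x≤z free = swept (trans (cong rep (sym (key-constant x≤z free))) rep-x)

  Γ-meets : x < y → R x y → ∃ λ z → x ≤ z × z ≤ y × Γ z
  Γ-meets {x} {y} x<y Rxy with stall-or-free x y
  ... | inj₁ (s , st , x≤s , s≤y) = s , x≤s , s≤y , stall st
  ... | inj₂ free with rep-defined (free ≤-refl (<⇒≤ x<y))
  ...   | c , rep-x with rep-just rep-x
  ...     | ¬c , kc≡kx with Swept-meets x<y Rxy free ¬c kc≡kx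
  ...       | z , x≤z , z≤y , swept-z =
    z , x≤z , z≤y , Γ-swept rep-x x≤z (λ x≤s s≤z → free x≤s (≤-trans s≤z z≤y)) swept-z

  Γ-sparse : (∃₂ λ z z' → z ≢ z' × (x < z × z < y) × (x < z' × z' < y) × Γ z × Γ z') →
             R x y
  Γ-sparse (z , z' , z≢z' , (x<z , z<y) , (x<z' , z'<y) , Γz , Γz') with compare z z'
  ... | tri< z<z' _ _ = Γ-linked Γz Γz' z<z' x<z z'<y
  ... | tri≈ _ z≡z' _ = ⊥-elim (z≢z' z≡z')
  ... | tri> _ _ z'<z = Γ-linked Γz' Γz z'<z x<z' z<y

open Defs using (_≤_)

lemma1 : ∀ {a : Level} → ExcludedMiddle a →
    (α : Set a) (_<_ : Rel α a) → IsStrictTotalOrder _≡_ _<_ →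
    Complete _<_ →
    (R : Rel α a) → UpwardClosed _<_ R →
    Σ (Pred α a) λ γ → ∀ x y → x < y →
      ((R x y → ∃ λ z → _≤_ _<_ x z × _≤_ _<_ z y × γ z) ×
       ((∃₂ λ z z' → z ≢ z' × (x < z × z < y) × (x < z' × z' < y) × γ z × γ z') → R x y))
lemma1 em α _<_ sto complete R R-up = Γ , λ x y x<y → Γ-meets x<y , Γ-sparse
  where open Construction em sto complete R-up
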